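{- For $|q|<1$, \[ \sum_{n=1}^{\infty}\sum_{m=-n+1}^{n}q^{n^{2}+m^{2}}=-\frac{1}{4}+\frac{1}{4}\bigg(\sum_{n=-\infty}^{\infty}q^{2n^{2}}\bigg)^{2}+q\bigg(\sum_{n=0}^{\infty}q^{2n(n+1)}\bigg)^{2}. \] -}

module Defs where

open import Data.Nat as ℕ using (ℕ; zero; suc)
open import Data.Integer as ℤ using (ℤ; +_; -_)
open import Data.Rational as ℚ using (ℚ; 0ℚ; 1ℚ)
open import Data.List using (List; []; _∷_; map; foldr; upTo)
open import Relation.Nullary using (Dec; yes; no)

-- Formal power series in q with rational coefficients:
-- a series is its coefficient sequence, (f N) = coefficient of q^N.
FPS : Set
FPS = ℕ → ℚ

Σℚ : List ℚ → ℚ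
Σℚ = foldr ℚ._+_ 0ℚ

[_] : ∀ {P : Set} → Dec P → ℚ
[ yes _ ] = 1ℚ
[ no _ ]  = 0ℚ

ints : ℤ → ℕ → List ℤ
ints a zero    = []
ints a (suc k) = a ∷ ints (a ℤ.+ + 1) k

cst : ℚ → FPS
cst c zero    = c
cst c (suc _) = 0ℚ

_⊕_ : FPS → FPS → FPS
(f ⊕ g) N = f N ℚ.+ g N

scale : ℚ → FPS → FPS
scale c f N = c ℚ.* f N

_⊛_ : FPS → FPS → FPS
(f ⊛ g) N = Σℚ (map (λ k → f k ℚ.* g (N ℕ.∸ k)) (upTo (suc N)))

qtimes : FPS → FPS
qtimes f zero    = 0ℚ
qtimes f (suc N) = f N

-- LHS: Σ_{n≥1} Σ_{m=-n+1}^{n} q^{n²+m²}.  Coefficient of q^N counts pairs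
-- (n,m) with n ≥ 1, -n+1 ≤ m ≤ n, n²+m² = N; such n satisfy n ≤ N, so the
-- outer sum may be truncated to 1 ≤ n ≤ N.
lhsSeries : FPS
lhsSeries N =
  Σℚ (map (λ n → Σℚ (map (λ m → [ ((+ n) ℤ.* (+ n) ℤ.+ m ℤ.* m) ℤ.≟ + N ])
                          (ints (+ 1 ℤ.- + n) (n ℕ.+ n))))
          (map suc (upTo N)))

-- Σ_{n∈ℤ} q^{2n²}; terms with 2n² = N have |n| ≤ N.
thetaQ2 : FPS
thetaQ2 N = Σℚ (map (λ n → [ (+ 2) ℤ.* n ℤ.* n ℤ.≟ + N ]) (ints (- (+ N)) (suc (N ℕ.+ N))))

-- Σ_{n≥0} q^{2n(n+1)}; terms with 2n(n+1) = N have n ≤ N.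
psiQ2 : FPS
psiQ2 N = Σℚ (map (λ n → [ 2 ℕ.* n ℕ.* (n ℕ.+ 1) ℕ.≟ N ]) (upTo (suc N)))

rhsSeries : FPS
rhsSeries = (cst (ℚ.- (+ 1 ℚ./ 4)) ⊕ scale (+ 1 ℚ./ 4) (thetaQ2 ⊛ thetaQ2)) ⊕ qtimes (psiQ2 ⊛ psiQ2)

-- Write a lattice point (n , m) of the left-hand side (n ≥ 1, -n < m ≤ n) as u = n + m ≥ 1,
-- v = n - m ≥ 0, so u ≡ v (mod 2).  If both are even, (x , y) = (u / 2 , v / 2) ranges over
-- the quadrant {x > 0, y ≥ 0} and n² + m² = 2x² + 2y²; that quadrant and its three rotations
-- by 90° tile ℤ² ∖ {0}, so these points give (θ(q²)² - 1) / 4.  If both are odd,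
-- (a , b) = ((u - 1) / 2 , (v - 1) / 2) ranges over ℕ² and n² + m² = 1 + 2a(a + 1) + 2b(b + 1),
-- which gives q ψ(q²)².  Coefficientwise every series counts a finite fibre of a weight
-- function, and both decompositions are bijections between such fibres.
module Submission where

open import Algebra.Bundles using (AbelianGroup; CommutativeRing)
open import Data.Empty using (⊥; ⊥-elim)
open import Data.Fin using (Fin; toℕ)
open import Data.Fin.Patterns using (0F; 1F; 2F; 3F)
open import Data.Integer as ℤ using (ℤ; +_; -[1+_]; ∣_∣)
import Data.Integer.Properties as ℤ
open import Data.Integer.Tactic.RingSolver using (solve-∀)
open import Data.List using (List; []; _∷_; map; _++_; length; filter; upTo; allFin; cartesianProduct)
open import Data.List.Membership.Propositional using (_∈_)
open import Data.List.Membership.Propositional.Properties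
  using (∈-map⁺; ∈-map⁻; ∈-++⁺ˡ; ∈-++⁺ʳ; ∈-++⁻; ∈-filter⁺; ∈-filter⁻; ∈-upTo⁺; ∈-upTo⁻;
         ∈-cartesianProduct⁺; ∈-cartesianProduct⁻; ∈-allFin)
open import Data.List.Membership.Propositional.Properties.WithK using (unique∧set⇒bag)
open import Data.List.Properties
  using (length-map; length-++; map-∘; map-id-local; map-cong; map-applyUpTo)
open import Data.List.Relation.Binary.BagAndSetEquality using (∼bag⇒↭)
open import Data.List.Relation.Binary.Permutation.Propositional.Properties using (↭-length)
open import Data.List.Relation.Unary.All using (tabulate)
open import Data.List.Relation.Unary.AllPairs using ([]; _∷_)
open import Data.List.Relation.Unary.Any using (here; there)
open import Data.List.Relation.Unary.Unique.Propositional using (Unique)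
import Data.List.Relation.Unary.Unique.Propositional.Properties as Unique
open import Data.Nat using (ℕ; zero; suc; _+_; _*_; _∸_; _≤_; _<_; s≤s; _≟_)
import Data.Nat.Properties as ℕ
open import Data.Product using (_×_; _,_; proj₁; proj₂; Σ-syntax)
open import Data.Product.Properties using (,-injectiveʳ)
open import Data.Rational as ℚ using (ℚ; 1ℚ)
import Data.Rational.Properties as ℚ
open import Data.Sum as Sum using (_⊎_; inj₁; inj₂; [_,_]′)
open import Data.Sum.Properties using (inj₁-injective; inj₂-injective)
open import Data.Unit using (⊤; tt)
open import Function using (_∘_; id; _⇔_; mk⇔; Equivalence)
open import Relation.Binary.PropositionalEquality
  using (_≡_; _≢_; refl; sym; trans; cong; cong₂; subst; module ≡-Reasoning)
open import Relation.Nullary using (yes; no)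
open import Relation.Unary using (Decidable)

open import Algebra.Properties.Group (AbelianGroup.group ℤ.+-0-abelianGroup) using (∙-cancelˡ)
open import Algebra.Properties.Semiring.Mult (CommutativeRing.semiring ℚ.+-*-commutativeRing)
  using (×-homo-+; ×1-homo-*) renaming (_×_ to _×ℚ_)

open import Defs

record Enumerates {A : Set} (P : A → Set) (xs : List A) : Set where
  field
    unique   : Unique xs
    sound    : ∀ {x} → x ∈ xs → P x
    complete : ∀ {x} → P x → x ∈ xs

open Enumerates

unique⇒enumerates : {A : Set} {xs : List A} → Unique xs → Enumerates (_∈ xs) xs
unique⇒enumerates u = record { unique = u ; sound = id ; complete = id }

upTo-enumerates : ∀ n → Enumerates (_< n) (upTo n)
upTo-enumerates n = record { unique = Unique.upTo⁺ n ; sound = ∈-upTo⁻ ; complete = ∈-upTo⁺ }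

allFin-enumerates : ∀ n → Enumerates (λ _ → ⊤) (allFin n)
allFin-enumerates n = record { unique = Unique.allFin⁺ n ; sound = λ _ → tt ; complete = λ _ → ∈-allFin _ }

module _ {A : Set} {P : A → Set} where

  enumerations-length : ∀ {xs ys} → Enumerates P xs → Enumerates P ys → length xs ≡ length ys
  enumerations-length e e′ = ↭-length (∼bag⇒↭ (unique∧set⇒bag (unique e) (unique e′)
    (mk⇔ (complete e′ ∘ sound e) (complete e ∘ sound e′))))

module _ {A : Set} {P Q : A → Set} where

  Enumerates-resp-⇔ : (∀ {x} → P x ⇔ Q x) → ∀ {xs} → Enumerates P xs → Enumerates Q xs
  Enumerates-resp-⇔ P⇔Q e = record
    { unique   = unique e
    ; sound    = Equivalence.to P⇔Q ∘ sound e
    ; complete = complete e ∘ Equivalence.from P⇔Q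
    }

module _ {A : Set} {P Q : A → Set} where

  filter-enumerates : (Q? : Decidable Q) → ∀ {xs} → Enumerates P xs →
                      Enumerates (λ x → P x × Q x) (filter Q? xs)
  filter-enumerates Q? {xs} e = record
    { unique   = Unique.filter⁺ Q? (unique e)
    ; sound    = λ x∈ → let x∈xs , q = ∈-filter⁻ Q? {xs = xs} x∈ in sound e x∈xs , q
    ; complete = λ (p , q) → ∈-filter⁺ Q? (complete e p) q
    }

  filter-enumerates-⊆ : (Q? : Decidable Q) → ∀ {xs} → Enumerates P xs → (∀ {x} → Q x → P x) →
                        Enumerates Q (filter Q? xs)
  filter-enumerates-⊆ Q? e Q⊆P =
    Enumerates-resp-⇔ (mk⇔ proj₂ (λ q → Q⊆P q , q)) (filter-enumerates Q? e)

record Correspondence {A B : Set} (P : A → Set) (Q : B → Set) : Set where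
  field
    to       : A → B
    from     : B → A
    to-sat   : ∀ {x} → P x → Q (to x)
    from-sat : ∀ {y} → Q y → P (from y)
    from∘to  : ∀ {x} → P x → from (to x) ≡ x
    to∘from  : ∀ {y} → Q y → to (from y) ≡ y

module _ {A B : Set} {P : A → Set} {Q : B → Set} where

  map-enumerates : (C : Correspondence P Q) → ∀ {xs} → Enumerates P xs →
                   Enumerates Q (map (Correspondence.to C) xs)
  map-enumerates C {xs} e = record
    { unique   = Unique.map⁻ (subst Unique (sym from-map-to) (unique e))
    ; sound    = sound-map
    ; complete = λ q → subst (_∈ map to xs) (to∘from q) (∈-map⁺ to (complete e (from-sat q)))
    }
    where
    open Correspondence C
    from-map-to : map from (map to xs) ≡ xs
    from-map-to = trans (sym (map-∘ xs)) (map-id-local (tabulate (from∘to ∘ sound e)))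
    sound-map : ∀ {y} → y ∈ map to xs → Q y
    sound-map y∈ with ∈-map⁻ to y∈
    ... | x , x∈ , refl = to-sat (sound e x∈)

  correspondence-length : Correspondence P Q → ∀ {xs ys} → Enumerates P xs → Enumerates Q ys →
                          length xs ≡ length ys
  correspondence-length C {xs} e e′ =
    trans (sym (length-map (Correspondence.to C) xs)) (enumerations-length (map-enumerates C e) e′)

  cartesianProduct-enumerates : ∀ {xs ys} → Enumerates P xs → Enumerates Q ys →
                                Enumerates (λ (x , y) → P x × Q y) (cartesianProduct xs ys)
  cartesianProduct-enumerates {xs} {ys} e e′ = record
    { unique   = Unique.cartesianProduct⁺ (unique e) (unique e′)
    ; sound    = λ xy∈ → let x∈ , y∈ = ∈-cartesianProduct⁻ xs ys xy∈ in sound e x∈ , sound e′ y∈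
    ; complete = λ (p , q) → ∈-cartesianProduct⁺ (complete e p) (complete e′ q)
    }

  ⊎-enumerates : ∀ {xs ys} → Enumerates P xs → Enumerates Q ys →
                 Enumerates [ P , Q ]′ (map inj₁ xs ++ map inj₂ ys)
  ⊎-enumerates {xs} {ys} e e′ = record
    { unique   = Unique.++⁺ (Unique.map⁺ inj₁-injective (unique e))
                            (Unique.map⁺ inj₂-injective (unique e′)) disjoint
    ; sound    = sound-++
    ; complete = λ { {inj₁ x} p → ∈-++⁺ˡ (∈-map⁺ inj₁ (complete e p))
                   ; {inj₂ y} q → ∈-++⁺ʳ _ (∈-map⁺ inj₂ (complete e′ q)) }
    }
    where
    disjoint : ∀ {z} → z ∈ map inj₁ xs × z ∈ map inj₂ ys → ⊥
    disjoint (z∈₁ , z∈₂) with ∈-map⁻ inj₁ z∈₁ | ∈-map⁻ inj₂ z∈₂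
    ... | _ , _ , refl | _ , _ , ()
    sound-++ : ∀ {z} → z ∈ map inj₁ xs ++ map inj₂ ys → [ P , Q ]′ z
    sound-++ z∈ with ∈-++⁻ (map inj₁ xs) z∈
    ... | inj₁ z∈₁ with ∈-map⁻ inj₁ z∈₁
    ...   | _ , x∈ , refl = sound e x∈
    sound-++ z∈ | inj₂ z∈₂ with ∈-map⁻ inj₂ z∈₂
    ...   | _ , y∈ , refl = sound e′ y∈

sigmaList : {A B : Set} → List A → (A → List B) → List (A × B)
sigmaList []       h = []
sigmaList (x ∷ xs) h = map (x ,_) (h x) ++ sigmaList xs h

module _ {A B : Set} where

  ∈-sigmaList⁺ : ∀ {x y} xs (h : A → List B) → x ∈ xs → y ∈ h x → (x , y) ∈ sigmaList xs h
  ∈-sigmaList⁺ (x ∷ xs) h (here refl) y∈ = ∈-++⁺ˡ (∈-map⁺ (x ,_) y∈)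
  ∈-sigmaList⁺ (x ∷ xs) h (there x∈) y∈ = ∈-++⁺ʳ (map (x ,_) (h x)) (∈-sigmaList⁺ xs h x∈ y∈)

  ∈-sigmaList⁻ : ∀ {x y} xs (h : A → List B) → (x , y) ∈ sigmaList xs h → x ∈ xs × y ∈ h x
  ∈-sigmaList⁻ (x ∷ xs) h xy∈ with ∈-++⁻ (map (x ,_) (h x)) xy∈
  ... | inj₁ xy∈₁ with ∈-map⁻ (x ,_) xy∈₁
  ...   | _ , y∈ , refl = here refl , y∈
  ∈-sigmaList⁻ (x ∷ xs) h xy∈ | inj₂ xy∈₂ =
    let x∈ , y∈ = ∈-sigmaList⁻ xs h xy∈₂ in there x∈ , y∈

  sigmaList⁺ : ∀ {xs} (h : A → List B) → Unique xs → (∀ x → Unique (h x)) → Unique (sigmaList xs h)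
  sigmaList⁺ {[]}     h u uh = []
  sigmaList⁺ {x ∷ xs} h u@(_ ∷ u′) uh =
    Unique.++⁺ (Unique.map⁺ ,-injectiveʳ (uh x)) (sigmaList⁺ h u′ uh) disjoint
    where
    disjoint : ∀ {z} → z ∈ map (x ,_) (h x) × z ∈ sigmaList xs h → ⊥
    disjoint (z∈₁ , z∈₂) with ∈-map⁻ (x ,_) z∈₁
    ... | _ , _ , refl = Unique.Unique[x∷xs]⇒x∉xs u (proj₁ (∈-sigmaList⁻ xs h z∈₂))

module _ {A B : Set} {P : A → Set} {Q : A → B → Set} where

  sigmaList-enumerates : ∀ {xs} {h : A → List B} → Enumerates P xs → (∀ x → Enumerates (Q x) (h x)) →
                         Enumerates (λ (x , y) → P x × Q x y) (sigmaList xs h)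
  sigmaList-enumerates {xs} {h} e eh = record
    { unique   = sigmaList⁺ h (unique e) (unique ∘ eh)
    ; sound    = λ {(x , _)} xy∈ →
                   let x∈ , y∈ = ∈-sigmaList⁻ xs h xy∈ in sound e x∈ , sound (eh x) y∈
    ; complete = λ {(x , _)} (p , q) → ∈-sigmaList⁺ xs h (complete e p) (complete (eh x) q)
    }

ι : ℕ → ℚ
ι n = n ×ℚ 1ℚ

module _ {A : Set} {P : A → Set} (P? : Decidable P) where

  Σℚ-indicator : ∀ xs → Σℚ (map (λ x → [ P? x ]) xs) ≡ ι (length (filter P? xs))
  Σℚ-indicator []       = refl
  Σℚ-indicator (x ∷ xs) with P? x
  ... | yes _ = cong (1ℚ ℚ.+_) (Σℚ-indicator xs)
  ... | no  _ = trans (ℚ.+-identityˡ _) (Σℚ-indicator xs)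

Σℚ-length-sigmaList : {A B : Set} (xs : List A) (h : A → List B) →
                      Σℚ (map (λ x → ι (length (h x))) xs) ≡ ι (length (sigmaList xs h))
Σℚ-length-sigmaList []       h = refl
Σℚ-length-sigmaList (x ∷ xs) h = begin
  ι (length (h x)) ℚ.+ Σℚ (map (λ x → ι (length (h x))) xs)
    ≡⟨ cong₂ ℚ._+_ (cong ι (sym (length-map (x ,_) (h x)))) (Σℚ-length-sigmaList xs h) ⟩
  ι (length (map (x ,_) (h x))) ℚ.+ ι (length (sigmaList xs h))
    ≡⟨ sym (×-homo-+ 1ℚ (length (map (x ,_) (h x))) _) ⟩
  ι (length (map (x ,_) (h x)) + length (sigmaList xs h))
    ≡⟨ cong ι (sym (length-++ (map (x ,_) (h x)))) ⟩
  ι (length (sigmaList (x ∷ xs) h)) ∎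
  where open ≡-Reasoning

length-cartesianProduct : {A B : Set} (xs : List A) (ys : List B) →
                          length (cartesianProduct xs ys) ≡ length xs * length ys
length-cartesianProduct []       ys = refl
length-cartesianProduct (x ∷ xs) ys = begin
  length (map (x ,_) ys ++ cartesianProduct xs ys) ≡⟨ length-++ (map (x ,_) ys) ⟩
  length (map (x ,_) ys) + length (cartesianProduct xs ys)
    ≡⟨ cong₂ _+_ (length-map (x ,_) ys) (length-cartesianProduct xs ys) ⟩
  length ys + length xs * length ys ∎
  where open ≡-Reasoning

ι-length-cartesianProduct : {A B : Set} (xs : List A) (ys : List B) →
                            ι (length xs) ℚ.* ι (length ys) ≡ ι (length (cartesianProduct xs ys))
ι-length-cartesianProduct xs ys =
  trans (sym (×1-homo-* (length xs) (length ys))) (cong ι (sym (length-cartesianProduct xs ys)))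

-- f = Σ_{a : A} q ^ F a, i.e. every fibre of F is finite and f counts it.
GeneratingFunction : {A : Set} → (A → ℕ) → FPS → Set
GeneratingFunction {A} F f = ∀ N → Σ[ xs ∈ List A ] Enumerates (λ a → F a ≡ N) xs × f N ≡ ι (length xs)

module _ {A B : Set} {F : A → ℕ} {G : B → ℕ} {f g : FPS} where

  ⊛-generatingFunction : GeneratingFunction F f → GeneratingFunction G g →
                         GeneratingFunction (λ (a , b) → F a + G b) (f ⊛ g)
  ⊛-generatingFunction gf gg N = map proj₂ blocks , map-enumerates splitting blocks-enumerate , count
    where
    fibreF : ℕ → List A
    fibreF k = proj₁ (gf k)
    fibreG : ℕ → List B
    fibreG k = proj₁ (gg k)
    block : ℕ → List (A × B)
    block k = cartesianProduct (fibreF k) (fibreG (N ∸ k))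
    blocks : List (ℕ × (A × B))
    blocks = sigmaList (upTo (suc N)) block

    blocks-enumerate : Enumerates (λ (k , (a , b)) → k < suc N × (F a ≡ k × G b ≡ N ∸ k)) blocks
    blocks-enumerate = sigmaList-enumerates (upTo-enumerates (suc N))
      (λ k → cartesianProduct-enumerates (proj₁ (proj₂ (gf k))) (proj₁ (proj₂ (gg (N ∸ k)))))

    splitting : Correspondence (λ (k , (a , b)) → k < suc N × (F a ≡ k × G b ≡ N ∸ k))
                               (λ (a , b) → F a + G b ≡ N)
    splitting = record
      { to       = proj₂
      ; from     = λ (a , b) → F a , (a , b)
      ; to-sat   = λ { {_ , a , _} (s≤s k≤N , refl , Gb≡N∸k) →
                       trans (cong (λ n → F a + n) Gb≡N∸k) (ℕ.m+[n∸m]≡n k≤N) }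
      ; from-sat = λ { {a , b} refl → s≤s (ℕ.m≤m+n (F a) (G b)) , refl , sym (ℕ.m+n∸m≡n (F a) (G b)) }
      ; from∘to  = λ { (_ , refl , _) → refl }
      ; to∘from  = λ _ → refl
      }

    count : (f ⊛ g) N ≡ ι (length (map proj₂ blocks))
    count = begin
      Σℚ (map (λ k → f k ℚ.* g (N ∸ k)) (upTo (suc N)))
        ≡⟨ cong Σℚ (map-cong (λ k → trans (cong₂ ℚ._*_ (proj₂ (proj₂ (gf k))) (proj₂ (proj₂ (gg (N ∸ k)))))
                                          (ι-length-cartesianProduct (fibreF k) (fibreG (N ∸ k))))
                             (upTo (suc N))) ⟩
      Σℚ (map (λ k → ι (length (block k))) (upTo (suc N))) ≡⟨ Σℚ-length-sigmaList (upTo (suc N)) block ⟩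
      ι (length blocks)                                   ≡⟨ cong ι (sym (length-map proj₂ blocks)) ⟩
      ι (length (map proj₂ blocks)) ∎
      where open ≡-Reasoning

ints-≡-map : ∀ c m → ints c m ≡ map (λ j → c ℤ.+ + j) (upTo m)
ints-≡-map c zero    = refl
ints-≡-map c (suc m) = begin
  c ∷ ints (c ℤ.+ + 1) m
    ≡⟨ cong₂ _∷_ (sym (ℤ.+-identityʳ c)) (ints-≡-map (c ℤ.+ + 1) m) ⟩
  c ℤ.+ + 0 ∷ map (λ j → (c ℤ.+ + 1) ℤ.+ + j) (upTo m)
    ≡⟨ cong (_ ∷_) (map-cong (λ j → ℤ.+-assoc c (+ 1) (+ j)) (upTo m)) ⟩
  c ℤ.+ + 0 ∷ map (λ j → c ℤ.+ + suc j) (upTo m)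
    ≡⟨ cong (_ ∷_) (map-∘ (upTo m)) ⟩
  c ℤ.+ + 0 ∷ map (λ j → c ℤ.+ + j) (map suc (upTo m))
    ≡⟨ cong (λ js → _ ∷ map (λ j → c ℤ.+ + j) js) (map-applyUpTo id suc m) ⟩
  map (λ j → c ℤ.+ + j) (upTo (suc m)) ∎
  where open ≡-Reasoning

ints⁺ : ∀ c m → Unique (ints c m)
ints⁺ c m = subst Unique (sym (ints-≡-map c m))
  (Unique.map⁺ (ℤ.+-injective ∘ ∙-cancelˡ c _ _) (Unique.upTo⁺ m))

∈-ints⁺ : ∀ {c m j x} → j < m → c ℤ.+ + j ≡ x → x ∈ ints c m
∈-ints⁺ {c} {m} j<m refl =
  subst (_ ∈_) (sym (ints-≡-map c m)) (∈-map⁺ (λ j → c ℤ.+ + j) (∈-upTo⁺ j<m))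

θweight : ℤ → ℕ
θweight x = 2 * ∣ x ∣ * ∣ x ∣

θweight-ℤ : ∀ x → (+ 2) ℤ.* x ℤ.* x ≡ + θweight x
θweight-ℤ (+ n)    = sym (trans (ℤ.pos-* (2 * n) n) (cong (ℤ._* + n) (ℤ.pos-* 2 n)))
θweight-ℤ -[1+ n ] = trans (square-neg (+ suc n)) (θweight-ℤ (+ suc n))
  where
  square-neg : ∀ x → (+ 2) ℤ.* ℤ.- x ℤ.* ℤ.- x ≡ (+ 2) ℤ.* x ℤ.* x
  square-neg = solve-∀

n≤2*n*n : ∀ n → n ≤ 2 * n * n
n≤2*n*n zero    = ℕ.≤-refl
n≤2*n*n (suc n) = ℕ.≤-trans (ℕ.m≤m+n (suc n) _) (ℕ.m≤m*n (2 * suc n) (suc n))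

∣x∣≤k⇒x∈ints : ∀ {x k} → ∣ x ∣ ≤ k → x ∈ ints (ℤ.- + k) (suc (k + k))
∣x∣≤k⇒x∈ints {+ n} n≤k with ℕ.m≤n⇒∃[o]m+o≡n n≤k
... | d , refl = ∈-ints⁺ (s≤s (ℕ.+-monoʳ-≤ (n + d) (ℕ.m≤m+n n d))) (shift (+ n) (+ d))
  where
  shift : ∀ x e → ℤ.- (x ℤ.+ e) ℤ.+ ((x ℤ.+ e) ℤ.+ x) ≡ x
  shift = solve-∀
∣x∣≤k⇒x∈ints { -[1+ n ]} n<k with ℕ.m≤n⇒∃[o]m+o≡n n<k
... | d , refl = ∈-ints⁺ (s≤s (ℕ.≤-trans (ℕ.m≤n+m d (suc n)) (ℕ.m≤m+n _ _))) (shift (+ suc n) (+ d))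
  where
  shift : ∀ x e → ℤ.- (x ℤ.+ e) ℤ.+ e ≡ ℤ.- x
  shift = solve-∀

θ-fibre-⇔ : ∀ {x k} → ((+ 2) ℤ.* x ℤ.* x ≡ + k) ⇔ (θweight x ≡ k)
θ-fibre-⇔ {x} = mk⇔ (λ eq → ℤ.+-injective (trans (sym (θweight-ℤ x)) eq))
                    (λ eq → trans (θweight-ℤ x) (cong +_ eq))

thetaQ2-generatingFunction : GeneratingFunction θweight thetaQ2
thetaQ2-generatingFunction k = filter θ? window , enumerates , Σℚ-indicator θ? window
  where
  θ? : Decidable (λ x → (+ 2) ℤ.* x ℤ.* x ≡ + k)
  θ? x = (+ 2) ℤ.* x ℤ.* x ℤ.≟ + k
  window : List ℤ
  window = ints (ℤ.- + k) (suc (k + k))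
  in-window : ∀ {x} → (+ 2) ℤ.* x ℤ.* x ≡ + k → x ∈ window
  in-window {x} eq =
    ∣x∣≤k⇒x∈ints (subst (∣ x ∣ ≤_) (Equivalence.to (θ-fibre-⇔ {x}) eq) (n≤2*n*n ∣ x ∣))
  enumerates : Enumerates (λ x → θweight x ≡ k) (filter θ? window)
  enumerates = Enumerates-resp-⇔ (λ {x} → θ-fibre-⇔ {x})
    (filter-enumerates-⊆ θ? (unique⇒enumerates (ints⁺ (ℤ.- + k) (suc (k + k)))) in-window)

ψweight : ℕ → ℕ
ψweight n = 2 * n * (n + 1)

n≤ψweight : ∀ n → n ≤ ψweight n
n≤ψweight n = ℕ.≤-trans (n≤2*n*n n) (ℕ.*-monoʳ-≤ (2 * n) (ℕ.m≤m+n n 1))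

ψweight-ℤ : ∀ a → (+ 2) ℤ.* + a ℤ.* (+ a ℤ.+ + 1) ≡ + ψweight a
ψweight-ℤ a = sym (trans (ℤ.pos-* (2 * a) (a + 1)) (cong (ℤ._* + (a + 1)) (ℤ.pos-* 2 a)))

psiQ2-generatingFunction : GeneratingFunction ψweight psiQ2
psiQ2-generatingFunction k =
  filter ψ? (upTo (suc k)) ,
  filter-enumerates-⊆ ψ? (upTo-enumerates (suc k)) (λ {n} eq → s≤s (subst (n ≤_) eq (n≤ψweight n))) ,
  Σℚ-indicator ψ? (upTo (suc k))
  where
  ψ? : Decidable (λ n → ψweight n ≡ k)
  ψ? n = ψweight n ≟ k

fromParity : ℕ ⊎ ℕ → ℕ
fromParity (inj₁ a) = suc (a + a)
fromParity (inj₂ a) = a + a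

toParity : ℕ → ℕ ⊎ ℕ
toParity zero    = inj₂ 0
toParity (suc j) = [ inj₂ ∘ suc , inj₁ ]′ (toParity j)

toParity-double : ∀ a → toParity (a + a) ≡ inj₂ a
toParity-double zero    = refl
toParity-double (suc a) rewrite ℕ.+-suc a a | toParity-double a = refl

toParity-fromParity : ∀ t → toParity (fromParity t) ≡ t
toParity-fromParity (inj₁ a) = cong [ inj₂ ∘ suc , inj₁ ]′ (toParity-double a)
toParity-fromParity (inj₂ a) = toParity-double a

fromParity-toParity : ∀ j → fromParity (toParity j) ≡ j
fromParity-toParity zero = refl
fromParity-toParity (suc j) with toParity j | fromParity-toParity j
... | inj₁ a | refl = cong suc (ℕ.+-suc a a)
... | inj₂ a | refl = refl

fromParity<⇔ : ∀ t {i} → fromParity t < suc i + suc i ⇔ Sum.reduce t ≤ i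
fromParity<⇔ t {i} = mk⇔ (half≤ t) (fromParity< t)
  where
  double< : ∀ {a} → a ≤ i → suc (a + a) < suc i + suc i
  double< {a} a≤i = s≤s (subst (_≤ i + suc i) (ℕ.+-suc a a) (ℕ.+-mono-≤ a≤i (s≤s a≤i)))
  fromParity< : ∀ t → Sum.reduce t ≤ i → fromParity t < suc i + suc i
  fromParity< (inj₁ a) a≤i = double< a≤i
  fromParity< (inj₂ a) a≤i = ℕ.<-trans (ℕ.n<1+n (a + a)) (double< a≤i)
  half≤ : ∀ t → fromParity t < suc i + suc i → Sum.reduce t ≤ i
  half≤ t lt = ℕ.≮⇒≥ (λ i<a → ℕ.<⇒≱ lt (ℕ.≤-trans (ℕ.+-mono-≤ i<a i<a) (fromParity-≥ t)))
    where
    fromParity-≥ : ∀ t → Sum.reduce t + Sum.reduce t ≤ fromParity t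
    fromParity-≥ (inj₁ a) = ℕ.n≤1+n (a + a)
    fromParity-≥ (inj₂ a) = ℕ.≤-refl

quadrantWeight : ℕ × ℕ → ℕ
quadrantWeight (a , b) = θweight (+ suc a) + θweight (+ b)

oddWeight : ℕ × ℕ → ℕ
oddWeight (a , b) = ψweight a + ψweight b

lhsWeight : (ℕ × ℕ) ⊎ (ℕ × ℕ) → ℕ
lhsWeight = [ quadrantWeight , suc ∘ oddWeight ]′

-- The window point (i , j) is the lattice point n = i + 1, m = j - i of lhsSeries.
windowNorm : ℕ × ℕ → ℤ
windowNorm (i , j) =
  (+ suc i) ℤ.* (+ suc i) ℤ.+ ((+ 1 ℤ.- + suc i) ℤ.+ + j) ℤ.* ((+ 1 ℤ.- + suc i) ℤ.+ + j)

-- inj₁ (a , b) is the point with n + m = 2a + 2, n - m = 2b; inj₂ (a , b) the one with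
-- n + m = 2a + 1, n - m = 2b + 1.
toWindow : (ℕ × ℕ) ⊎ (ℕ × ℕ) → ℕ × ℕ
toWindow (inj₁ (a , b)) = a + b , fromParity (inj₁ a)
toWindow (inj₂ (a , b)) = a + b , fromParity (inj₂ a)

fromWindow : ℕ × ℕ → (ℕ × ℕ) ⊎ (ℕ × ℕ)
fromWindow (i , j) = Sum.map (λ a → a , i ∸ a) (λ a → a , i ∸ a) (toParity j)

windowNorm-toWindow : ∀ x → windowNorm (toWindow x) ≡ + lhsWeight x
windowNorm-toWindow (inj₁ (a , b)) =
  trans (identity (+ a) (+ b)) (cong₂ ℤ._+_ (θweight-ℤ (+ suc a)) (θweight-ℤ (+ b)))
  where
  identity : ∀ x y →
    (+ 1 ℤ.+ (x ℤ.+ y)) ℤ.* (+ 1 ℤ.+ (x ℤ.+ y))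
      ℤ.+ ((+ 1 ℤ.- (+ 1 ℤ.+ (x ℤ.+ y))) ℤ.+ (+ 1 ℤ.+ (x ℤ.+ x)))
      ℤ.* ((+ 1 ℤ.- (+ 1 ℤ.+ (x ℤ.+ y))) ℤ.+ (+ 1 ℤ.+ (x ℤ.+ x)))
    ≡ (+ 2) ℤ.* (+ 1 ℤ.+ x) ℤ.* (+ 1 ℤ.+ x) ℤ.+ (+ 2) ℤ.* y ℤ.* y
  identity = solve-∀
windowNorm-toWindow (inj₂ (a , b)) =
  trans (identity (+ a) (+ b)) (cong (λ w → + 1 ℤ.+ w) (cong₂ ℤ._+_ (ψweight-ℤ a) (ψweight-ℤ b)))
  where
  identity : ∀ x y →
    (+ 1 ℤ.+ (x ℤ.+ y)) ℤ.* (+ 1 ℤ.+ (x ℤ.+ y))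
      ℤ.+ ((+ 1 ℤ.- (+ 1 ℤ.+ (x ℤ.+ y))) ℤ.+ (x ℤ.+ x))
      ℤ.* ((+ 1 ℤ.- (+ 1 ℤ.+ (x ℤ.+ y))) ℤ.+ (x ℤ.+ x))
    ≡ + 1 ℤ.+ ((+ 2) ℤ.* x ℤ.* (x ℤ.+ + 1) ℤ.+ (+ 2) ℤ.* y ℤ.* (y ℤ.+ + 1))
  identity = solve-∀

fromWindow-toWindow : ∀ x → fromWindow (toWindow x) ≡ x
fromWindow-toWindow (inj₁ (a , b)) rewrite toParity-fromParity (inj₁ a) =
  cong (λ c → inj₁ (a , c)) (ℕ.m+n∸m≡n a b)
fromWindow-toWindow (inj₂ (a , b)) rewrite toParity-fromParity (inj₂ a) =
  cong (λ c → inj₂ (a , c)) (ℕ.m+n∸m≡n a b)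

toWindow-fromWindow : ∀ {i j} → j < suc i + suc i → toWindow (fromWindow (i , j)) ≡ (i , j)
toWindow-fromWindow {i} {j} j<w with toParity j | fromParity-toParity j
... | inj₁ a | refl = cong (_, j) (ℕ.m+[n∸m]≡n (Equivalence.to (fromParity<⇔ (inj₁ a)) j<w))
... | inj₂ a | refl = cong (_, j) (ℕ.m+[n∸m]≡n (Equivalence.to (fromParity<⇔ (inj₂ a)) j<w))

toWindow-inWindow : ∀ x → let (i , j) = toWindow x in j < suc i + suc i
toWindow-inWindow (inj₁ (a , b)) = Equivalence.from (fromParity<⇔ (inj₁ a)) (ℕ.m≤m+n a b)
toWindow-inWindow (inj₂ (a , b)) = Equivalence.from (fromParity<⇔ (inj₂ a)) (ℕ.m≤m+n a b)

toWindow-< : ∀ x → proj₁ (toWindow x) < lhsWeight x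
toWindow-< (inj₁ (a , b)) = ℕ.+-mono-≤ (n≤2*n*n (suc a)) (n≤2*n*n b)
toWindow-< (inj₂ (a , b)) = s≤s (ℕ.+-mono-≤ (n≤ψweight a) (n≤ψweight b))

InWindow : ℕ → ℕ × ℕ → Set
InWindow N (i , j) = i < N × (j < suc i + suc i × windowNorm (i , j) ≡ + N)

windowCorrespondence : ∀ N → Correspondence (InWindow N) (λ x → lhsWeight x ≡ N)
windowCorrespondence N = record
  { to       = fromWindow
  ; from     = toWindow
  ; to-sat   = λ { {i , j} (_ , j<w , norm≡N) → ℤ.+-injective (begin
      + lhsWeight (fromWindow (i , j))         ≡⟨ sym (windowNorm-toWindow (fromWindow (i , j))) ⟩
      windowNorm (toWindow (fromWindow (i , j))) ≡⟨ cong windowNorm (toWindow-fromWindow j<w) ⟩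
      windowNorm (i , j)                       ≡⟨ norm≡N ⟩
      + N                                      ∎) }
  ; from-sat = λ { {x} refl → toWindow-< x , toWindow-inWindow x , windowNorm-toWindow x }
  ; from∘to  = λ (_ , j<w , _) → toWindow-fromWindow j<w
  ; to∘from  = λ {x} _ → fromWindow-toWindow x
  }
  where open ≡-Reasoning

windowRow : ℕ → ℕ → List ℕ
windowRow N i = filter (λ j → windowNorm (i , j) ℤ.≟ + N) (upTo (suc i + suc i))

windowPoints : ℕ → List (ℕ × ℕ)
windowPoints N = sigmaList (upTo N) (windowRow N)

windowPoints-enumerates : ∀ N → Enumerates (InWindow N) (windowPoints N)
windowPoints-enumerates N =
  sigmaList-enumerates (upTo-enumerates N)
    (λ i → filter-enumerates (λ j → windowNorm (i , j) ℤ.≟ + N) (upTo-enumerates (suc i + suc i)))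

lhsSeries-windowPoints : ∀ N → lhsSeries N ≡ ι (length (windowPoints N))
lhsSeries-windowPoints N = begin
  lhsSeries N
    ≡⟨ cong Σℚ (sym (map-∘ (upTo N))) ⟩
  Σℚ (map (λ i → Σℚ (map (indicator i) (ints (+ 1 ℤ.- + suc i) (suc i + suc i)))) (upTo N))
    ≡⟨ cong Σℚ (map-cong reindex (upTo N)) ⟩
  Σℚ (map (λ i → Σℚ (map (λ j → [ windowNorm (i , j) ℤ.≟ + N ]) (upTo (suc i + suc i)))) (upTo N))
    ≡⟨ cong Σℚ (map-cong (λ i → Σℚ-indicator (λ j → windowNorm (i , j) ℤ.≟ + N) (upTo (suc i + suc i)))
                         (upTo N)) ⟩
  Σℚ (map (λ i → ι (length (windowRow N i))) (upTo N))
    ≡⟨ Σℚ-length-sigmaList (upTo N) (windowRow N) ⟩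
  ι (length (windowPoints N)) ∎
  where
  open ≡-Reasoning
  indicator : ℕ → ℤ → ℚ
  indicator i m = [ (+ suc i) ℤ.* (+ suc i) ℤ.+ m ℤ.* m ℤ.≟ + N ]
  reindex : ∀ i → Σℚ (map (indicator i) (ints (+ 1 ℤ.- + suc i) (suc i + suc i))) ≡
                  Σℚ (map (λ j → [ windowNorm (i , j) ℤ.≟ + N ]) (upTo (suc i + suc i)))
  reindex i = cong Σℚ (trans (cong (map (indicator i)) (ints-≡-map (+ 1 ℤ.- + suc i) (suc i + suc i)))
                             (sym (map-∘ (upTo (suc i + suc i)))))

lhsSeries-generatingFunction : GeneratingFunction lhsWeight lhsSeries
lhsSeries-generatingFunction N =
  map fromWindow (windowPoints N) ,
  map-enumerates (windowCorrespondence N) (windowPoints-enumerates N) ,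
  trans (lhsSeries-windowPoints N) (cong ι (sym (length-map fromWindow (windowPoints N))))

rot90 : ℤ × ℤ → ℤ × ℤ
rot90 (x , y) = ℤ.- y , x

rotate : ℕ → ℤ × ℤ → ℤ × ℤ
rotate zero    = id
rotate (suc k) = rot90 ∘ rotate k

θnorm : ℤ × ℤ → ℕ
θnorm (x , y) = θweight x + θweight y

θnorm-rotate : ∀ k z → θnorm (rotate k z) ≡ θnorm z
θnorm-rotate zero    z = refl
θnorm-rotate (suc k) z = trans (θnorm-rot90 (rotate k z)) (θnorm-rotate k z)
  where
  θnorm-rot90 : ∀ z → θnorm (rot90 z) ≡ θnorm z
  θnorm-rot90 (x , y) =
    trans (cong (λ n → 2 * n * n + θweight x) (ℤ.∣-i∣≡∣i∣ y)) (ℕ.+-comm (θweight y) (θweight x))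

-- The origin, which lies in no rotated quadrant, gets a junk value.
quadrantOf : ℤ × ℤ → Fin 4 × (ℕ × ℕ)
quadrantOf (+ suc a  , + b)      = 0F , (a , b)
quadrantOf (+ 0      , + suc a)  = 1F , (a , 0)
quadrantOf (-[1+ b ] , + suc a)  = 1F , (a , suc b)
quadrantOf (-[1+ a ] , + 0)      = 2F , (a , 0)
quadrantOf (-[1+ a ] , -[1+ b ]) = 2F , (a , suc b)
quadrantOf (+ b      , -[1+ a ]) = 3F , (a , b)
quadrantOf (+ 0      , + 0)      = 0F , (0 , 0)

fromQuadrant : Fin 4 × (ℕ × ℕ) → ℤ × ℤ
fromQuadrant (k , (a , b)) = rotate (toℕ k) (+ suc a , + b)

quadrantOf-fromQuadrant : ∀ q → quadrantOf (fromQuadrant q) ≡ q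
quadrantOf-fromQuadrant (0F , (a , b))     = refl
quadrantOf-fromQuadrant (1F , (a , zero))  = refl
quadrantOf-fromQuadrant (1F , (a , suc b)) = refl
quadrantOf-fromQuadrant (2F , (a , zero))  = refl
quadrantOf-fromQuadrant (2F , (a , suc b)) = refl
quadrantOf-fromQuadrant (3F , (a , zero))  = refl
quadrantOf-fromQuadrant (3F , (a , suc b)) = refl

fromQuadrant-quadrantOf : ∀ z → z ≢ (+ 0 , + 0) → fromQuadrant (quadrantOf z) ≡ z
fromQuadrant-quadrantOf (+ suc a  , + b)      _ = refl
fromQuadrant-quadrantOf (+ 0      , + suc a)  _ = refl
fromQuadrant-quadrantOf (-[1+ b ] , + suc a)  _ = refl
fromQuadrant-quadrantOf (-[1+ a ] , + 0)      _ = refl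
fromQuadrant-quadrantOf (-[1+ a ] , -[1+ b ]) _ = refl
fromQuadrant-quadrantOf (+ zero   , -[1+ a ]) _ = refl
fromQuadrant-quadrantOf (+ suc b  , -[1+ a ]) _ = refl
fromQuadrant-quadrantOf (+ 0      , + 0)      z≢0 = ⊥-elim (z≢0 refl)

rotationCorrespondence : ∀ M → Correspondence (λ (_ , p) → ⊤ × quadrantWeight p ≡ suc M)
                                              (λ z → θnorm z ≡ suc M)
rotationCorrespondence M = record
  { to       = fromQuadrant
  ; from     = quadrantOf
  ; to-sat   = λ { {k , (a , b)} (_ , eq) → trans (θnorm-rotate (toℕ k) (+ suc a , + b)) eq }
  ; from-sat = λ {z} eq → tt , (begin
      quadrantWeight (proj₂ (quadrantOf z))  ≡⟨ sym (θnorm-rotate (toℕ (proj₁ (quadrantOf z))) _) ⟩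
      θnorm (fromQuadrant (quadrantOf z))    ≡⟨ cong θnorm (fromQuadrant-quadrantOf z (nonzero eq)) ⟩
      θnorm z                                ≡⟨ eq ⟩
      suc M                                  ∎)
  ; from∘to  = λ {q} _ → quadrantOf-fromQuadrant q
  ; to∘from  = λ {z} eq → fromQuadrant-quadrantOf z (nonzero eq)
  }
  where
  nonzero : ∀ {z} → θnorm z ≡ suc M → z ≢ (+ 0 , + 0)
  nonzero eq refl = ℕ.0≢1+n eq
  open ≡-Reasoning

quadrantFibre : ∀ N → Σ[ ps ∈ List (ℕ × ℕ) ] Enumerates (λ p → quadrantWeight p ≡ N) ps
quadrantFibre N =
  filter (λ p → quadrantWeight p ≟ N) box ,
  filter-enumerates-⊆ (λ p → quadrantWeight p ≟ N)
    (cartesianProduct-enumerates (upTo-enumerates (suc N)) (upTo-enumerates (suc N))) bounds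
  where
  box : List (ℕ × ℕ)
  box = cartesianProduct (upTo (suc N)) (upTo (suc N))
  bounds : ∀ {p} → quadrantWeight p ≡ N → proj₁ p < suc N × proj₂ p < suc N
  bounds {a , b} refl =
    s≤s (ℕ.≤-trans (ℕ.n≤1+n a) (ℕ.≤-trans (n≤2*n*n (suc a)) (ℕ.m≤m+n _ _))) ,
    s≤s (ℕ.≤-trans (n≤2*n*n b) (ℕ.m≤n+m _ _))

quarter-ι-4* : ∀ n → (+ 1 ℚ./ 4) ℚ.* ι (4 * n) ≡ ι n
quarter-ι-4* n = begin
  (+ 1 ℚ./ 4) ℚ.* ι (4 * n)        ≡⟨ cong ((+ 1 ℚ./ 4) ℚ.*_) (×1-homo-* 4 n) ⟩
  (+ 1 ℚ./ 4) ℚ.* (ι 4 ℚ.* ι n)    ≡⟨ sym (ℚ.*-assoc (+ 1 ℚ./ 4) (ι 4) (ι n)) ⟩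
  ((+ 1 ℚ./ 4) ℚ.* ι 4) ℚ.* ι n    ≡⟨ ℚ.*-identityˡ (ι n) ⟩
  ι n                              ∎
  where open ≡-Reasoning

lhsWeight-fibre-length : ∀ {M Ls Qs Ss} →
  Enumerates (λ x → lhsWeight x ≡ suc M) Ls → Enumerates (λ p → quadrantWeight p ≡ suc M) Qs →
  Enumerates (λ p → oddWeight p ≡ M) Ss → length Ls ≡ length Qs + length Ss
lhsWeight-fibre-length {M} {Ls} {Qs} {Ss} enumL enumQ enumS = begin
  length Ls                                   ≡⟨ enumerations-length enumL
                                                   (Enumerates-resp-⇔ (λ {x} → split⇔ x) (⊎-enumerates enumQ enumS)) ⟩
  length (map inj₁ Qs ++ map inj₂ Ss)         ≡⟨ length-++ (map inj₁ Qs) ⟩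
  length (map inj₁ Qs) + length (map inj₂ Ss) ≡⟨ cong₂ _+_ (length-map inj₁ Qs) (length-map inj₂ Ss) ⟩
  length Qs + length Ss                       ∎
  where
  open ≡-Reasoning
  split⇔ : ∀ x → [ (λ p → quadrantWeight p ≡ suc M) , (λ p → oddWeight p ≡ M) ]′ x ⇔
                  (lhsWeight x ≡ suc M)
  split⇔ (inj₁ _) = mk⇔ id id
  split⇔ (inj₂ _) = mk⇔ (cong suc) ℕ.suc-injective

θnorm-fibre-length : ∀ {M Ts Qs} →
  Enumerates (λ z → θnorm z ≡ suc M) Ts → Enumerates (λ p → quadrantWeight p ≡ suc M) Qs →
  length Ts ≡ 4 * length Qs
θnorm-fibre-length {M} {Ts} {Qs} enumT enumQ = begin
  length Ts                                ≡⟨ sym (correspondence-length (rotationCorrespondence M)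
                                                (cartesianProduct-enumerates (allFin-enumerates 4) enumQ) enumT) ⟩
  length (cartesianProduct (allFin 4) Qs)  ≡⟨ length-cartesianProduct (allFin 4) Qs ⟩
  4 * length Qs                            ∎
  where open ≡-Reasoning

lemma3p1 : (N : ℕ) → lhsSeries N ≡ rhsSeries N
lemma3p1 zero = refl
lemma3p1 (suc M)
  with lhsSeries-generatingFunction (suc M)
     | ⊛-generatingFunction thetaQ2-generatingFunction thetaQ2-generatingFunction (suc M)
     | ⊛-generatingFunction psiQ2-generatingFunction psiQ2-generatingFunction M
     | quadrantFibre (suc M)
... | Ls , enumL , lhs≡ | Ts , enumT , θθ≡ | Ss , enumS , ψψ≡ | Qs , enumQ = begin
  lhsSeries (suc M)                  ≡⟨ lhs≡ ⟩
  ι (length Ls)                      ≡⟨ cong ι (lhsWeight-fibre-length enumL enumQ enumS) ⟩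
  ι (length Qs + length Ss)          ≡⟨ ×-homo-+ 1ℚ (length Qs) (length Ss) ⟩
  ι (length Qs) ℚ.+ ι (length Ss)    ≡⟨ cong₂ ℚ._+_ (sym (quarter-ι-4* (length Qs))) (sym ψψ≡) ⟩
  (+ 1 ℚ./ 4) ℚ.* ι (4 * length Qs) ℚ.+ (psiQ2 ⊛ psiQ2) M
    ≡⟨ cong (λ t → (+ 1 ℚ./ 4) ℚ.* t ℚ.+ (psiQ2 ⊛ psiQ2) M)
            (trans (cong ι (sym (θnorm-fibre-length enumT enumQ))) (sym θθ≡)) ⟩
  (+ 1 ℚ./ 4) ℚ.* (thetaQ2 ⊛ thetaQ2) (suc M) ℚ.+ (psiQ2 ⊛ psiQ2) M
    ≡⟨ cong (ℚ._+ (psiQ2 ⊛ psiQ2) M) (sym (ℚ.+-identityˡ (scale (+ 1 ℚ./ 4) (thetaQ2 ⊛ thetaQ2) (suc M)))) ⟩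
  rhsSeries (suc M)                  ∎
  where open ≡-Reasoning
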